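{- There exists no $\rho$-competitive online exploration algorithm with $\rho<2$ for the collaborative tree exploration problem with energy-bounded agents.
   Context: An instance is $I=\langle T,r,k,B\rangle$: $T$ is a finite undirected tree, initially unknown, rooted at $r$; $k$ agents start at $r$; each agent can traverse at most $B$ edges in total. At every vertex $v$ the incident edges carry locally distinct labels (port numbers) $0,\dots,\delta_v-1$ ($\delta_v$ the degree of $v$). When an agent arrives at a new vertex it learns the port number of the arrival edge and the degree of the vertex; all information (map of the explored part, agent positions) is instantly shared among all agents. The goal is to maximize the number of distinct vertices visited. For an online algorithm $\textsc{Alg}$, $|\textsc{Alg}(I)|$ is the number of distinct vertices it visits, and $|\textsc{Opt}(I)|$ is the maximum number of distinct vertices that $k$ agents with budget $B$ starting at $r$ can visit when $T$ is known in advance. $\textsc{Alg}$ is $\rho$-competitive if $\sup_I |\textsc{Opt}(I)|/|\textsc{Alg}(I)|\le\rho$. -}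

module Defs where

open import Data.Nat using (ℕ; zero; suc; _+_; _*_; _∸_; _≤_; _<_; _<ᵇ_; _≡ᵇ_)
open import Data.Nat.Properties using (_<?_; _≟_)
open import Data.Fin using (Fin; toℕ; fromℕ<)
open import Data.List using (List; []; _∷_; reverse; length; deduplicate)
open import Data.List.Properties using (≡-dec)
open import Data.Maybe using (Maybe; just; nothing)
open import Data.Product using (_×_; _,_)
open import Data.Bool using (Bool; true; false; if_then_else_)
open import Relation.Nullary using (¬_; yes; no)

-- A non-root vertex with c children has degree suc c; its edge to the
-- parent carries the local port pp : Fin (suc c); its j-th child
-- (j < c) is reached through local port  j  if j < pp  and  j+1
-- otherwise (i.e. punchIn pp j).  The root with d children has degree
-- d and its j-th child is behind port j.  Every finite rooted tree with
-- every local port labelling is represented (up to isomorphism).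

data Sub : Set where
  sub : (c : ℕ) → Fin (suc c) → (Fin c → Sub) → Sub

data Tree : Set where
  root : (d : ℕ) → (Fin d → Sub) → Tree

data Node : Set where
  rootN : (d : ℕ) → (Fin d → Sub) → Node
  subN  : (c : ℕ) → Fin (suc c) → (Fin c → Sub) → Node

degS : Sub → ℕ
degS (sub c _ _) = suc c

parentPortS : Sub → ℕ
parentPortS (sub _ pp _) = toℕ pp

degN : Node → ℕ
degN (rootN d _)  = d
degN (subN c _ _) = suc c

lookupKid : (n : ℕ) → (Fin n → Sub) → ℕ → Maybe Sub
lookupKid n ks j with j <? n
... | yes j<n = just (ks (fromℕ< j<n))
... | no  _   = nothing

-- vertices are addressed by the sequence of child indices from the root
subAt : Sub → List ℕ → Maybe Node
subAt (sub c pp ks) [] = just (subN c pp ks)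
subAt (sub c pp ks) (j ∷ js) with lookupKid c ks j
... | just s  = subAt s js
... | nothing = nothing

nodeAt : Tree → List ℕ → Maybe Node
nodeAt (root d ks) [] = just (rootN d ks)
nodeAt (root d ks) (j ∷ js) with lookupKid d ks j
... | just s  = subAt s js
... | nothing = nothing

childPort : Node → ℕ → ℕ
childPort (rootN _ _)   j = j
childPort (subN _ pp _) j = if j <ᵇ toℕ pp then j else suc j

portChild : Node → ℕ → Maybe (ℕ × Sub)
portChild (rootN d ks) p with lookupKid d ks p
... | just s  = just (p , s)
... | nothing = nothing
portChild (subN c pp ks) p =
  if p <ᵇ toℕ pp
  then (withIdx p (lookupKid c ks p))
  else (if p ≡ᵇ toℕ pp then nothing else withIdx (p ∸ 1) (lookupKid c ks (p ∸ 1)))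
  where
  withIdx : ℕ → Maybe Sub → Maybe (ℕ × Sub)
  withIdx j (just s) = just (j , s)
  withIdx j nothing  = nothing

isParentPort : Node → ℕ → Bool
isParentPort (rootN _ _)   p = false
isParentPort (subN _ pp _) p = p ≡ᵇ toℕ pp

-- Movement.  Positions are addresses stored leaf-first (head = last
-- child index).  An observation on arrival is
-- (port number of the arrival edge at the new vertex , degree of new vertex).

Obs : Set
Obs = ℕ × ℕ

moveTarget : Tree → List ℕ → ℕ → Maybe (List ℕ × Obs)
moveTarget T a p with nodeAt T (reverse a)
... | nothing = nothing
... | just n with portChild n p
...   | just (j , s) = just (j ∷ a , (parentPortS s , degS s))
...   | nothing with isParentPort n p | a
...     | true | (i ∷ a') with nodeAt T (reverse a')
...       | just m  = just (a' , (childPort m i , degN m))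
...       | nothing = nothing
moveTarget T a p | just n | nothing | true  | [] = nothing
moveTarget T a p | just n | nothing | false | _  = nothing

rootDeg : Tree → ℕ
rootDeg (root d _) = d

-- At each step the (centralised, fully
-- informed) strategy either stops or moves one agent through one port.
-- The history records (agent , port , observation) of all past moves,
-- most recent first.  An online algorithm only sees k, B, the degree
-- of the root and the history; an offline strategy (used to define
-- Opt) is any strategy chosen after the tree is known.

data Action : Set where
  stop : Action
  move : (agent port : ℕ) → Action

Step : Set
Step = ℕ × ℕ × Obs

Strategy : Set
Strategy = (k B rootDegree : ℕ) → List Step → Action

record State : Set where
  constructor st
  field
    pos     : ℕ → List ℕ
    used    : ℕ → ℕ             -- number of edges traversed by each agent
    visited : List (List ℕ)
    hist    : List Step

update : {A : Set} → (ℕ → A) → ℕ → A → (ℕ → A)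
update f i x j = if j ≡ᵇ i then x else f j

initState : State
initState = st (λ _ → []) (λ _ → 0) ([] ∷ []) []

-- Run with fuel; an illegal action (agent index ≥ k, exhausted budget,
-- nonexistent port) terminates the run like `stop`.
run : Strategy → Tree → (k B fuel : ℕ) → State → State
run S T k B zero s = s
run S T k B (suc f) s with S k B (rootDeg T) (State.hist s)
... | stop = s
... | move i p with i <? k | State.used s i <? B | moveTarget T (State.pos s i) p
...   | yes _ | yes _ | just (a , o) =
        run S T k B f (st (update (State.pos s) i a)
                          (update (State.used s) i (suc (State.used s i)))
                          (a ∷ State.visited s)
                          ((i , p , o) ∷ State.hist s))
...   | _ | _ | _ = s

-- Number of distinct vertices visited by strategy S on instance
-- ⟨T, root, k, B⟩.  Fuel k * B suffices: every legal move consumes one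
-- unit of budget of one of the k agents.
visits : Strategy → Tree → (k B : ℕ) → ℕ
visits S T k B =
  length (deduplicate (≡-dec _≟_) (State.visited (run S T k B (k * B) initState)))

-- Alg is (p/q)-competitive: for every instance, |Opt(I)| ≤ (p/q)|Alg(I)|,
-- where |Opt(I)| is the maximum of visits over all (offline) strategies.
Competitive : Strategy → (p q : ℕ) → Set
Competitive Alg p q =
  (T : Tree) (k B : ℕ) (S : Strategy) → q * visits S T k B ≤ p * visits Alg T k B

module Submission where

-- One agent with budget B = ℓ + 1 explores the star with B + 1 leaves.  Within B moves the
-- algorithm tries at most B ports, so some root port j is never tried, and hanging a path of
-- length ℓ below leaf j leaves its run unchanged.  On the star the agent alternates between the
-- root and the leaves, so it sees at most (B + 3)/2 = (ℓ + 4)/2 vertices, while an offline agent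
-- walks down the path and sees ℓ + 2.  A ratio p/q < 2, i.e. p ≤ 2q - 1, then forces
-- 2q(ℓ + 2) ≤ (2q - 1)(ℓ + 4), that is ℓ + 4 ≤ 4q, which fails for ℓ = 4q.

open import Defs
open import Data.Nat using (ℕ; zero; suc; _+_; _*_; _≤_; _<_; _≡ᵇ_; z≤n; s≤s)
open import Data.Nat.Properties
open import Data.Nat.Tactic.RingSolver using (solve-∀)
open import Data.Fin using (toℕ)
open import Data.Fin.Properties using (toℕ-fromℕ<)
open import Data.List using (List; []; _∷_; _∷ʳ_; reverse; length; replicate; filter; deduplicate)
import Data.List.Properties as List
open import Data.List.Relation.Unary.All as All using (All; []; _∷_)
open import Data.List.Relation.Unary.Any as Any using (here; there; any?)
open import Data.List.Membership.Propositional using (_∈_; _∉_)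
open import Data.List.Membership.Propositional.Properties using (∈-deduplicate⁺; ∈-deduplicate⁻; ∈-filter⁺)
open import Data.Maybe using (just; nothing)
open import Data.Product using (_×_; _,_; proj₁; proj₂; ∃-syntax)
open import Data.Bool using (true; false; if_then_else_)
open import Data.Sum using (_⊎_; inj₁; inj₂)
open import Data.Empty using (⊥-elim)
open import Function using (_∘_)
open import Relation.Nullary using (¬_; Dec; yes; no; ¬?)
open import Relation.Binary.PropositionalEquality

_≟ᴸ_ : (xs ys : List ℕ) → Dec (xs ≡ ys)
_≟ᴸ_ = List.≡-dec _≟_

distinct : List (List ℕ) → ℕ
distinct xs = length (deduplicate _≟ᴸ_ xs)

distinct-∷-≤ : ∀ x xs → distinct (x ∷ xs) ≤ suc (distinct xs)
distinct-∷-≤ x xs = s≤s (List.length-filter (¬? ∘ _≟ᴸ_ x) (deduplicate _≟ᴸ_ xs))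

distinct-∷-∈ : ∀ {x xs} → x ∈ xs → distinct (x ∷ xs) ≤ distinct xs
distinct-∷-∈ {x} {xs} x∈xs = List.filter-notAll (¬? ∘ _≟ᴸ_ x) (deduplicate _≟ᴸ_ xs)
  (Any.map (λ x≡y x≢y → x≢y x≡y) (∈-deduplicate⁺ _≟ᴸ_ x∈xs))

distinct-∷-∉ : ∀ {x xs} → x ∉ xs → distinct (x ∷ xs) ≡ suc (distinct xs)
distinct-∷-∉ {x} {xs} x∉xs = cong (suc ∘ length) (List.filter-all (¬? ∘ _≟ᴸ_ x)
  (All.tabulate (λ y∈ x≡y → x∉xs (subst (_∈ xs) (sym x≡y) (∈-deduplicate⁻ _≟ᴸ_ xs y∈)))))

∃-∉-below : ∀ N (ps : List ℕ) → length ps < N → ∃[ j ] j < N × j ∉ ps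
∃-∉-below (suc N) ps |ps|<1+N with any? (N ≟_) ps
... | no N∉ps = N , ≤-refl , N∉ps
... | yes N∈ps
    with ∃-∉-below N (filter (¬? ∘ (N ≟_)) ps)
           (≤-trans (List.filter-notAll (¬? ∘ (N ≟_)) ps (Any.map (λ e ne → ne e) N∈ps))
                    (≤-pred |ps|<1+N))
...   | j , j<N , j∉ = j , m≤n⇒m≤1+n j<N ,
          λ j∈ps → j∉ (∈-filter⁺ (¬? ∘ (N ≟_)) j∈ps (λ N≡j → <-irrefl (sym N≡j) j<N))

leaf : Sub
leaf = sub 0 Data.Fin.zero (λ ())

-- Below its top vertex, path ℓ descends ℓ further edges, always through port 1.
path : ℕ → Sub
path zero    = leaf
path (suc ℓ) = sub 1 Data.Fin.zero (λ _ → path ℓ)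

star : ℕ → Tree
star d = root d (λ _ → leaf)

starWith : (d j : ℕ) → Sub → Tree
starWith d j s = root d (λ x → if toℕ x ≡ᵇ j then s else leaf)

≢⇒≡ᵇ-false : ∀ {m n} → m ≢ n → (m ≡ᵇ n) ≡ false
≢⇒≡ᵇ-false {m} {n} m≢n with m ≡ᵇ n | ≡ᵇ⇒≡ m n
... | false | _    = refl
... | true  | m≡n = ⊥-elim (m≢n (m≡n _))

≡ᵇ-refl : ∀ n → (n ≡ᵇ n) ≡ true
≡ᵇ-refl zero    = refl
≡ᵇ-refl (suc n) = ≡ᵇ-refl n

module _ {d : ℕ} where

  star-move-root : ∀ {p a o} → moveTarget (star d) [] p ≡ just (a , o) → a ≡ p ∷ []
  star-move-root {p} eq with p <? d
  star-move-root refl | yes _ = refl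
  star-move-root ()   | no _

  star-move-leaf : ∀ {m p a o} → moveTarget (star d) (m ∷ []) p ≡ just (a , o) → a ≡ []
  star-move-leaf {m} eq with m <? d
  star-move-leaf {p = zero}  refl | yes _ = refl
  star-move-leaf {p = suc p} ()   | yes _
  star-move-leaf             ()   | no _

  module _ {j : ℕ} {s : Sub} where

    starWith-move-root : ∀ {p} → p ≢ j → moveTarget (starWith d j s) [] p ≡ moveTarget (star d) [] p
    starWith-move-root {p} p≢j with p <? d
    ... | yes p<d rewrite toℕ-fromℕ< p<d | ≢⇒≡ᵇ-false p≢j = refl
    ... | no _ = refl

    starWith-move-leaf : ∀ {m p} → m ≢ j →
                         moveTarget (starWith d j s) (m ∷ []) p ≡ moveTarget (star d) (m ∷ []) p
    starWith-move-leaf {m} m≢j with m <? d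
    starWith-move-leaf {p = zero}  m≢j | yes m<d rewrite toℕ-fromℕ< m<d | ≢⇒≡ᵇ-false m≢j = refl
    starWith-move-leaf {p = suc p} m≢j | yes m<d rewrite toℕ-fromℕ< m<d | ≢⇒≡ᵇ-false m≢j = refl
    ... | no _ = refl

afterMove : State → (agent : ℕ) → List ℕ → (port : ℕ) → Obs → State
afterMove s i a p o = st (update (State.pos s) i a)
                         (update (State.used s) i (suc (State.used s i)))
                         (a ∷ State.visited s)
                         ((i , p , o) ∷ State.hist s)

module Oblivious (Alg : Strategy) (d k B : ℕ) where

  -- The ports Alg tries on star d, including a final illegal attempt that ends the run.
  portsTried : (fuel : ℕ) → State → List ℕ
  portsAfter : (fuel : ℕ) → State → (agent port : ℕ) → List ℕ

  portsTried zero s = []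
  portsTried (suc f) s with Alg k B d (State.hist s)
  ... | stop     = []
  ... | move i p = p ∷ portsAfter f s i p

  portsAfter f s i p with i <? k | State.used s i <? B | moveTarget (star d) (State.pos s i) p
  ... | yes _ | yes _ | just (a , o) = portsTried f (afterMove s i a p o)
  ... | _     | _     | _            = []

  length-portsTried : ∀ f s → length (portsTried f s) ≤ f
  length-portsAfter : ∀ f s i p → length (portsAfter f s i p) ≤ f

  length-portsTried zero s = z≤n
  length-portsTried (suc f) s with Alg k B d (State.hist s)
  ... | stop     = z≤n
  ... | move i p = s≤s (length-portsAfter f s i p)

  length-portsAfter f s i p with i <? k | State.used s i <? B | moveTarget (star d) (State.pos s i) p
  ... | yes _ | yes _ | just (a , o) = length-portsTried f (afterMove s i a p o)
  ... | yes _ | yes _ | nothing      = z≤n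
  ... | yes _ | no _  | _            = z≤n
  ... | no _  | _     | _            = z≤n

  module _ (j : ℕ) (s₀ : Sub) where

    OffBranch : List ℕ → Set
    OffBranch a = a ≡ [] ⊎ ∃[ m ] a ≡ m ∷ [] × m ≢ j

    starWith-move : ∀ {a p} → OffBranch a → p ≢ j →
                    moveTarget (starWith d j s₀) a p ≡ moveTarget (star d) a p
    starWith-move (inj₁ refl)            p≢j = starWith-move-root {d} p≢j
    starWith-move (inj₂ (m , refl , m≢j)) p≢j = starWith-move-leaf {d} m≢j

    star-move-offBranch : ∀ {a p a′ o} → OffBranch a → p ≢ j →
                          moveTarget (star d) a p ≡ just (a′ , o) → OffBranch a′
    star-move-offBranch {p = p} (inj₁ refl) p≢j eq with star-move-root {d} {p} eq
    ... | refl = inj₂ (_ , refl , p≢j)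
    star-move-offBranch (inj₂ (m , refl , _)) p≢j eq with star-move-leaf {d} eq
    ... | refl = inj₁ refl

    ∉-∷⇒≢ : ∀ {p ps} → j ∉ p ∷ ps → p ≢ j
    ∉-∷⇒≢ j∉ p≡j = j∉ (here (sym p≡j))

    update-offBranch : ∀ (f : ℕ → List ℕ) i {a} → (∀ x → OffBranch (f x)) → OffBranch a →
                       ∀ x → OffBranch (update f i a x)
    update-offBranch f i off offₐ x with x ≡ᵇ i
    ... | true  = offₐ
    ... | false = off x

    run-starWith≡run-star : ∀ f s → (∀ x → OffBranch (State.pos s x)) → j ∉ portsTried f s →
                            run Alg (starWith d j s₀) k B f s ≡ run Alg (star d) k B f s
    run-starWith≡run-star zero s off j∉ = refl
    run-starWith≡run-star (suc f) s off j∉ with Alg k B d (State.hist s)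
    ... | stop = refl
    ... | move i p
        rewrite starWith-move {p = p} (off i) (∉-∷⇒≢ j∉)
        with i <? k | State.used s i <? B | moveTarget (star d) (State.pos s i) p in eq
    ...   | yes _ | yes _ | just (a , o) =
            run-starWith≡run-star f (afterMove s i a p o)
              (update-offBranch (State.pos s) i off
                 (star-move-offBranch (off i) (∉-∷⇒≢ j∉) eq))
              (j∉ ∘ there)
    ...   | yes _ | yes _ | nothing = refl
    ...   | yes _ | no _  | _       = refl
    ...   | no _  | _     | _       = refl

module Solo (Alg : Strategy) (d B : ℕ) where

  AtStar : List ℕ → Set
  AtStar a = a ≡ [] ⊎ ∃[ m ] a ≡ m ∷ []

  -- The lone agent alternates between the root and the leaves, so a new vertex costs two moves.
  record Invariant (s : State) : Set where
    constructor invariant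
    field
      onStar       : AtStar (State.pos s 0)
      withinBudget : State.used s 0 ≤ B
      rootVisited  : [] ∈ State.visited s
      fewVisited   : 2 * distinct (State.visited s) ≤ 2 + State.used s 0 + length (State.pos s 0)

  initial : Invariant initState
  initial = invariant (inj₁ refl) z≤n (here refl) ≤-refl

  final : ∀ {s} → Invariant s → 2 * distinct (State.visited s) ≤ 3 + B
  final {s} (invariant onStar u≤B _ few) = begin
    2 * distinct (State.visited s)              ≤⟨ few ⟩
    2 + State.used s 0 + length (State.pos s 0) ≤⟨ +-mono-≤ (+-monoʳ-≤ 2 u≤B) (length≤1 onStar) ⟩
    2 + B + 1                                   ≡⟨ +-comm (2 + B) 1 ⟩
    3 + B                                       ∎
    where
    open ≤-Reasoning
    length≤1 : ∀ {a} → AtStar a → length a ≤ 1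
    length≤1 (inj₁ refl)       = z≤n
    length≤1 (inj₂ (_ , refl)) = s≤s z≤n

  step : ∀ {s a p o} → Invariant s → State.used s 0 < B →
         moveTarget (star d) (State.pos s 0) p ≡ just (a , o) → Invariant (afterMove s 0 a p o)
  step {s} {p = p} (invariant (inj₁ atRoot) _ root∈ few) u<B eq rewrite atRoot
    with refl ← star-move-root {d} {p} eq =
    invariant (inj₂ (p , refl)) u<B (there root∈) (begin
      2 * distinct ((p ∷ []) ∷ State.visited s) ≤⟨ *-monoʳ-≤ 2 (distinct-∷-≤ (p ∷ []) (State.visited s)) ⟩
      2 * (1 + distinct (State.visited s))      ≡⟨ *-distribˡ-+ 2 1 (distinct (State.visited s)) ⟩
      2 + 2 * distinct (State.visited s)        ≤⟨ +-monoʳ-≤ 2 few ⟩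
      2 + (2 + State.used s 0 + 0)              ≡⟨ cong (4 +_) (+-identityʳ (State.used s 0)) ⟩
      4 + State.used s 0                        ≡⟨ cong (3 +_) (+-comm 1 (State.used s 0)) ⟩
      2 + suc (State.used s 0) + 1              ∎)
    where open ≤-Reasoning
  step {s} (invariant (inj₂ (m , atLeaf)) _ root∈ few) u<B eq rewrite atLeaf
    with refl ← star-move-leaf {d} eq =
    invariant (inj₁ refl) u<B (here refl) (begin
      2 * distinct ([] ∷ State.visited s) ≤⟨ *-monoʳ-≤ 2 (distinct-∷-∈ root∈) ⟩
      2 * distinct (State.visited s)      ≤⟨ few ⟩
      2 + State.used s 0 + 1              ≡⟨ cong (2 +_) (+-comm (State.used s 0) 1) ⟩
      2 + suc (State.used s 0)            ≡⟨ +-identityʳ (2 + suc (State.used s 0)) ⟨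
      2 + suc (State.used s 0) + 0        ∎)
    where open ≤-Reasoning

  run-invariant : ∀ f s → Invariant s → Invariant (run Alg (star d) 1 B f s)
  run-invariant zero s inv = inv
  run-invariant (suc f) s inv with Alg 1 B d (State.hist s)
  ... | stop = inv
  ... | move i p with i <? 1 | State.used s i <? B | moveTarget (star d) (State.pos s i) p in eq
  ...   | yes (s≤s z≤n) | yes u<B | just (a , o) = run-invariant f (afterMove s 0 a p o) (step inv u<B eq)
  ...   | yes (s≤s z≤n) | yes _   | nothing      = inv
  ...   | yes _         | no _    | _            = inv
  ...   | no _          | _       | _            = inv

  visits-star : 2 * visits Alg (star d) 1 B ≤ 3 + B
  visits-star = final (run-invariant (1 * B) initState initial)

replicate-∷ʳ : ∀ {A : Set} m (x : A) → replicate m x ∷ʳ x ≡ x ∷ replicate m x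
replicate-∷ʳ zero    x = refl
replicate-∷ʳ (suc m) x = cong (x ∷_) (replicate-∷ʳ m x)

reverse-replicate : ∀ {A : Set} m (x : A) → reverse (replicate m x) ≡ replicate m x
reverse-replicate zero    x = refl
reverse-replicate (suc m) x = begin
  reverse (x ∷ replicate m x) ≡⟨ List.unfold-reverse x (replicate m x) ⟩
  reverse (replicate m x) ∷ʳ x ≡⟨ cong (_∷ʳ x) (reverse-replicate m x) ⟩
  replicate m x ∷ʳ x           ≡⟨ replicate-∷ʳ m x ⟩
  x ∷ replicate m x            ∎
  where open ≡-Reasoning

subAt-path : ∀ m r → subAt (path (m + r)) (replicate m 0) ≡ subAt (path r) []
subAt-path zero    r = refl
subAt-path (suc m) r = subAt-path m r

arrival : Sub → Obs
arrival s = parentPortS s , degS s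

descend : ℕ → Strategy
descend j _ _ _ []      = move 0 j
descend j _ _ _ (_ ∷ _) = move 0 1

module Descent {d j : ℕ} (j<d : j < d) (ℓ : ℕ) where

  T : Tree
  T = starWith d j (path ℓ)

  -- Addresses are stored leaf-first, so the vertex at depth 1 + m on the branch is 0 ⋯ 0 j.
  branch : ℕ → List ℕ
  branch m = replicate m 0 ∷ʳ j

  trail : ℕ → List (List ℕ)
  trail zero    = [] ∷ []
  trail (suc m) = branch m ∷ trail m

  length-branch : ∀ m → length (branch m) ≡ suc m
  length-branch m = trans (List.length-++ (replicate m 0))
                          (trans (+-comm (length (replicate m 0)) 1) (cong suc (List.length-replicate m)))

  trail-shorter : ∀ m → All (λ a → length a ≤ m) (trail m)
  trail-shorter zero    = z≤n ∷ []
  trail-shorter (suc m) = ≤-reflexive (length-branch m) ∷ All.map m≤n⇒m≤1+n (trail-shorter m)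

  branch∉trail : ∀ m → branch m ∉ trail m
  branch∉trail m b∈ = 1+n≰n (subst (_≤ m) (length-branch m) (All.lookup (trail-shorter m) b∈))

  distinct-trail : ∀ m → distinct (trail m) ≡ suc m
  distinct-trail zero    = refl
  distinct-trail (suc m) = trans (distinct-∷-∉ (branch∉trail m)) (cong suc (distinct-trail m))

  nodeAt-branch : ∀ xs → nodeAt T (j ∷ xs) ≡ subAt (path ℓ) xs
  nodeAt-branch xs with j <? d
  ... | yes j<d′ rewrite toℕ-fromℕ< j<d′ | ≡ᵇ-refl j = refl
  ... | no j≮d = ⊥-elim (j≮d j<d)

  move-first : moveTarget T [] j ≡ just (branch 0 , arrival (path ℓ))
  move-first with j <? d
  ... | yes j<d′ rewrite toℕ-fromℕ< j<d′ | ≡ᵇ-refl j = refl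
  ... | no j≮d = ⊥-elim (j≮d j<d)

  move-down : ∀ m r → ℓ ≡ m + suc r → moveTarget T (branch m) 1 ≡ just (branch (suc m) , arrival (path r))
  move-down m r ℓ≡ rewrite List.reverse-++ (replicate m 0) (j ∷ []) | reverse-replicate m 0
                         | nodeAt-branch (replicate m 0) | ℓ≡ | subAt-path m (suc r) = refl

  run-descend : ∀ r m s → ℓ ≡ m + r → State.pos s 0 ≡ branch m → State.used s 0 ≡ suc m →
                descend j 1 (suc ℓ) d (State.hist s) ≡ move 0 1 → State.visited s ≡ trail (suc m) →
                State.visited (run (descend j) T 1 (suc ℓ) r s) ≡ trail (suc m + r)
  run-descend zero m s ℓ≡ _ _ _ visited≡ rewrite +-identityʳ m = visited≡
  run-descend (suc r) m s ℓ≡ pos≡ used≡ next≡ visited≡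
    rewrite next≡ | pos≡ | move-down m r ℓ≡ with State.used s 0 <? suc ℓ
  ... | yes _ = trans (run-descend r (suc m) (afterMove s 0 (branch (suc m)) 1 (arrival (path r)))
                        (trans ℓ≡ (+-suc m r)) refl (cong suc used≡) refl (cong (branch (suc m) ∷_) visited≡))
                      (cong trail (sym (+-suc (suc m) r)))
  ... | no u≮ = ⊥-elim (u≮ (subst (_< suc ℓ) (sym used≡) (s≤s (subst (m <_) (sym ℓ≡) (m<m+n m (s≤s z≤n))))))

  visits-descend : visits (descend j) T 1 (suc ℓ) ≡ 2 + ℓ
  visits-descend rewrite move-first =
    trans (cong distinct (run-descend (ℓ + 0) 0 (afterMove initState 0 (branch 0) j (arrival (path ℓ)))
                            (sym (+-identityʳ ℓ)) refl refl refl refl))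
          (trans (distinct-trail (1 + (ℓ + 0))) (cong (2 +_) (+-identityʳ ℓ)))

ratio-gap : ∀ {p q n v} → p < 2 * q → q * (2 + n) ≤ p * v → 2 * v ≤ 4 + n → 4 + n ≤ 4 * q
ratio-gap {p} {q} {n} {v} p<2q opt≤alg alg≤ = +-cancelˡ-≤ (2 * (q * (2 + n))) (4 + n) (4 * q) (begin
  2 * (q * (2 + n)) + (4 + n) ≤⟨ +-monoˡ-≤ (4 + n) (*-monoʳ-≤ 2 opt≤alg) ⟩
  2 * (p * v) + (4 + n)       ≡⟨ cong (_+ (4 + n)) (swap-2 p v) ⟩
  p * (2 * v) + (4 + n)       ≤⟨ +-monoˡ-≤ (4 + n) (*-monoʳ-≤ p alg≤) ⟩
  p * (4 + n) + (4 + n)       ≡⟨ +-comm (p * (4 + n)) (4 + n) ⟩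
  suc p * (4 + n)             ≤⟨ *-monoˡ-≤ (4 + n) p<2q ⟩
  2 * q * (4 + n)             ≡⟨ expand q n ⟩
  2 * (q * (2 + n)) + 4 * q   ∎)
  where
  open ≤-Reasoning
  swap-2 : ∀ p v → 2 * (p * v) ≡ p * (2 * v)
  swap-2 = solve-∀
  expand : ∀ q n → 2 * q * (4 + n) ≡ 2 * (q * (2 + n)) + 4 * q
  expand = solve-∀

proposition1 : (Alg : Strategy) (p q : ℕ) → p < 2 * q → ¬ Competitive Alg p q
proposition1 Alg p q p<2q competitive = 1+n≰n (≤-trans (m≤n+m (1 + ℓ) 3) ratio)
  where
  ℓ B d : ℕ
  ℓ = 4 * q
  B = suc ℓ
  d = suc B
  open Oblivious Alg d 1 B

  untried : ∃[ j ] j < d × j ∉ portsTried (1 * B) initState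
  untried = ∃-∉-below d (portsTried (1 * B) initState)
              (s≤s (≤-trans (length-portsTried (1 * B) initState) (≤-reflexive (*-identityˡ B))))
  j : ℕ
  j = proj₁ untried

  same-run : run Alg (starWith d j (path ℓ)) 1 B (1 * B) initState ≡ run Alg (star d) 1 B (1 * B) initState
  same-run = run-starWith≡run-star j (path ℓ) (1 * B) initState (λ _ → inj₁ refl) (proj₂ (proj₂ untried))

  opt≤alg : q * (2 + ℓ) ≤ p * visits Alg (star d) 1 B
  opt≤alg = subst₂ (λ o a → q * o ≤ p * a) (Descent.visits-descend (proj₁ (proj₂ untried)) ℓ)
              (cong (distinct ∘ State.visited) same-run) (competitive (starWith d j (path ℓ)) 1 B (descend j))

  ratio : 4 + ℓ ≤ 4 * q
  ratio = ratio-gap {p} {q} p<2q opt≤alg (Solo.visits-star Alg d B)
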